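{- For every marked perfect matching $\mathfrak{m}$ with respect to $(n_1,\dots,n_k)$, $\mathrm{wt}(\Phi(\mathfrak{m}))+\mathrm{cross}(\Phi(\mathfrak{m}))=\mathrm{wt}(\mathfrak{m})+\mathrm{cross}(\mathfrak{m})$.
   Context: Fix positive integers $n_1,\dots,n_k$ and $N=n_1+\dots+n_k$. Let $\pi$ be a permutation of $[N]$, viewed as a perfect matching with edges $e_i=(i,\overline{\pi(i)})$. An edge $e_i$ is homogeneous if $n_1+\dots+n_{r-1}+1\le i,\pi(i)\le n_1+\dots+n_r$ for some $r\in[k]$, inhomogeneous otherwise; $E^H(\pi)$ is the set of homogeneous edges. A marked perfect matching is a pair $\mathfrak{m}=(\pi,S)$ with $S$ a set of edges of $\pi$ containing all inhomogeneous edges (edges in $S$ are marked). $\mathrm{bind}^U_{\mathfrak{m}}(i)$ is $1$ plus the number of $u<i$ with $e_u\in S$; $\mathrm{bind}^L_{\mathfrak{m}}(j)$ is $1$ plus the number of $v<j$ such that the edge with lower endpoint $\bar v$ is in $S$; $\mathrm{bdiff}_{\mathfrak{m}}(e_i)=\mathrm{bind}^L_{\mathfrak{m}}(\pi(i))-\mathrm{bind}^U_{\mathfrak{m}}(i)$. Define $\mathrm{wt}(\mathfrak{m})=\sum_{e:\,\mathrm{bdiff}_{\mathfrak{m}}(e)\ge0}\mathrm{bdiff}_{\mathfrak{m}}(e)+\sum_{e:\,\mathrm{bdiff}_{\mathfrak{m}}(e)<0}(-\mathrm{bdiff}_{\mathfrak{m}}(e)-1)$ (sums over edges of $\pi$).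 Two edges $e_a,e_b$ cross if $(a-b)(\pi(a)-\pi(b))<0$; $\mathrm{cross}(\mathfrak{m})$ is the number of crossing pairs of edges both not in $S$ minus the number of crossing pairs of edges both in $S$. Say $e_j$ crosses $e_i$ from the left (equivalently $e_i$ crosses $e_j$ from the right) if $j<i$ and $\pi(j)>\pi(i)$. A homogeneous edge $e$ is convertible in $\mathfrak{m}$ if: when $e\notin S$, every edge $e'$ crossing $e$ either crosses $e$ from the left with $\mathrm{bdiff}_{\mathfrak{m}}(e')\ge0$ or crosses $e$ from the right with $\mathrm{bdiff}_{\mathfrak{m}}(e')\le-1$; when $e\in S$, every edge $e'$ crossing $e$ either crosses $e$ from the left with $\mathrm{bdiff}_{\mathfrak{m}}(e')>0$ or crosses $e$ from the right with $\mathrm{bdiff}_{\mathfrak{m}}(e')<-1$. $\triangle$ denotes symmetric difference. The map $\Phi$ on marked perfect matchings is defined as follows. Case 0: if $E^H(\pi)=\emptyset$, $\Phi(\mathfrak{m})=\mathfrak{m}$. Case 1: if $E^H(\pi)\ne\emptyset$ and $\mathrm{bdiff}_{\mathfrak{m}}(e)\ge0$ for all $e\in E^H(\pi)$, then $\Phi(\mathfrak{m})=(\pi,S\triangle\{e_i\})$ where $\pi(i)=\min\{\pi(j):e_j\in E^H(\pi)\}$. Case 2: otherwise let $i=\min\{j: e_j\in E^H(\pi),\ \mathrm{bdiff}_{\mathfrak{m}}(e_j)<0\}$; (a) if $e_i$ is convertible in $\mathfrak{m}$, $\Phi(\mathfrak{m})=(\pi,S\triangle\{e_i\})$; (b) if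 not, $\Phi(\mathfrak{m})=(\pi,S\triangle\{e_{i'}\})$ with $i'=\max\{j<i: e_j\in E^H(\pi),\ \mathrm{bdiff}_{\mathfrak{m}}(e_j)=0,\ e_j\text{ crosses } e_i\}$ (this set is nonempty in case (b), so $\Phi$ is well defined). -}

module Defs where

open import Data.Bool using (Bool; true; false; if_then_else_; _∧_; _∨_; not)
open import Data.Nat as ℕ using (ℕ; zero; suc; _<ᵇ_; _≡ᵇ_)
open import Data.Integer as ℤ using (ℤ; +_; _-_; -_; _≤ᵇ_; 0ℤ; -1ℤ; 1ℤ)
open import Data.Fin using (Fin; toℕ)
open import Data.List using (List; []; _∷_; allFin; filterᵇ; length; foldr; map; head; last; null)
open import Data.Nat.ListAction using (sum)
open import Data.List using (cartesianProduct)
open import Data.Bool.ListAction using (and)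
open import Data.Maybe using (Maybe; just; nothing)
open import Data.Product using (_×_; _,_)
open import Data.Fin.Permutation using (Permutation′; _⟨$⟩ʳ_; _⟨$⟩ˡ_)

-- Conventions: positions are 0-indexed, i.e. the paper's index i ∈ [N]
-- corresponds to  Fin N  element with toℕ = i - 1.  An edge e_i is
-- identified with its upper endpoint i : Fin N; its lower endpoint is π(i).
-- A set S of edges is a Boolean predicate on upper endpoints.

allᵇ : {A : Set} → (A → Bool) → List A → Bool
allᵇ p xs = and (map p xs)

block : List ℕ → ℕ → ℕ
block []       x = 0
block (n ∷ ns) x = if x <ᵇ n then 0 else suc (block ns (x ℕ.∸ n))

Tot : List ℕ → ℕ
Tot = sum

-- raw (unchecked) marked matchings: a permutation together with a set S of edges
Raw : ℕ → Set
Raw N = Permutation′ N × (Fin N → Bool)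

module _ {N : ℕ} (ns : List ℕ) (π : Permutation′ N) (S : Fin N → Bool) where

  π[_] : Fin N → ℕ
  π[ i ] = toℕ (π ⟨$⟩ʳ i)

  hom : Fin N → Bool
  hom i = block ns (toℕ i) ≡ᵇ block ns π[ i ]

  count : (Fin N → Bool) → ℕ
  count p = length (filterᵇ p (allFin N))

  bindU : Fin N → ℕ
  bindU i = suc (count (λ u → (toℕ u <ᵇ toℕ i) ∧ S u))

  bindL : Fin N → ℕ
  bindL j = suc (count (λ v → (toℕ v <ᵇ toℕ j) ∧ S (π ⟨$⟩ˡ v)))

  bdiff : Fin N → ℤ
  bdiff i = + bindL (π ⟨$⟩ʳ i) - + bindU i

  wtTerm : ℤ → ℤ
  wtTerm d = if 0ℤ ≤ᵇ d then d else (- d - 1ℤ)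

  sumℤ : List ℤ → ℤ
  sumℤ = foldr ℤ._+_ 0ℤ

  wt : ℤ
  wt = sumℤ (map (λ i → wtTerm (bdiff i)) (allFin N))

  -- e_j crosses e_i from the left (equivalently e_i crosses e_j from the right)
  crossesLeft : Fin N → Fin N → Bool
  crossesLeft j i = (toℕ j <ᵇ toℕ i) ∧ (π[ i ] <ᵇ π[ j ])

  crosses : Fin N → Fin N → Bool
  crosses a b = crossesLeft a b ∨ crossesLeft b a

  crossPairs : (Fin N → Bool) → ℕ
  crossPairs p = length (filterᵇ (λ ab → go ab) (cartesianProduct (allFin N) (allFin N)))
    where
      go : Fin N × Fin N → Bool
      go (a , b) = (toℕ a <ᵇ toℕ b) ∧ crosses a b ∧ p a ∧ p b

  cross : ℤ
  cross = + crossPairs (λ e → not (S e)) - + crossPairs S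

  infix 4 _<ℤᵇ_
  _<ℤᵇ_ : ℤ → ℤ → Bool
  x <ℤᵇ y = not (y ≤ᵇ x)

  convertible : Fin N → Bool
  convertible i = if S i
    then allᵇ (λ j → not (crosses j i) ∨
                    (crossesLeft j i ∧ (0ℤ <ℤᵇ bdiff j)) ∨
                    (crossesLeft i j ∧ (bdiff j <ℤᵇ -1ℤ)))
             (allFin N)
    else allᵇ (λ j → not (crosses j i) ∨
                    (crossesLeft j i ∧ (0ℤ ≤ᵇ bdiff j)) ∨
                    (crossesLeft i j ∧ (bdiff j ≤ᵇ -1ℤ)))
             (allFin N)

  toggle : Fin N → (Fin N → Bool)
  toggle i j = if toℕ j ≡ᵇ toℕ i then not (S j) else S j

  homs : List (Fin N)
  homs = filterᵇ hom (allFin N)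

  negHoms : List (Fin N)
  negHoms = filterᵇ (λ j → hom j ∧ (bdiff j <ℤᵇ 0ℤ)) (allFin N)

  argminLower : Maybe (Fin N)
  argminLower = head (filterᵇ (λ i → allᵇ (λ j → π[ i ] ℕ.≤ᵇ π[ j ]) homs) homs)

  -- candidates for case 2(b), in increasing order; the max is the last one
  case2b : Fin N → Maybe (Fin N)
  case2b i = last (filterᵇ (λ j → (toℕ j <ᵇ toℕ i) ∧ hom j ∧
                                  (bdiff j ≡ᵇℤ 0ℤ) ∧ crosses j i) (allFin N))
    where
      infix 4 _≡ᵇℤ_
      _≡ᵇℤ_ : ℤ → ℤ → Bool
      x ≡ᵇℤ y = (x ≤ᵇ y) ∧ (y ≤ᵇ x)

  -- Φ; returns nothing only if a minimum/maximum of an empty set would be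
  -- needed (which the paper asserts never happens).
  Φ : Maybe (Raw N)
  Φ with null homs
  ... | true = just (π , S)
  ... | false with negHoms
  ...   | [] with argminLower
  ...     | nothing = nothing
  ...     | just i  = just (π , toggle i)
  Φ | false | i ∷ _ with convertible i
  ...     | true  = just (π , toggle i)
  ...     | false with case2b i
  ...       | nothing = nothing
  ...       | just i' = just (π , toggle i')

Marked : {N : ℕ} → List ℕ → Permutation′ N → (Fin N → Bool) → Set
Marked ns π S = ∀ i → hom ns π S i ≡ false → S i ≡ true
  where open import Relation.Binary.PropositionalEquality using (_≡_)

wtR : {N : ℕ} → List ℕ → Raw N → ℤ
wtR ns (π , S) = wt ns π S

crossR : {N : ℕ} → List ℕ → Raw N → ℤ
crossR ns (π , S) = cross ns π S

-- Write U and L for bind^U − 1 and bind^L − 1, so that bdiff(e_j) = L(j) − U(j).  Toggling the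
-- mark of e_i leaves bdiff(e_j) unchanged unless e_j crosses e_i, and otherwise changes it by one:
-- through L for a left crosser, through U for a right crosser.  Convertibility of e_i says exactly
-- that each such change moves the weight term of e_j by one, opposite to the change of cross, which
-- equals (#crossing pairs) − Σ_{e marked} (#edges crossing e).  Hence wt + cross is invariant when
-- Φ toggles a convertible edge.  That Φ always does rests on the block structure: an edge with just
-- one endpoint before the start of a block is inhomogeneous, hence marked, so U and L agree at
-- every block start, and comparing counts through such a cut gives the bounds needed in each case.

module Submission where

open import Defs
import Algebra.Properties.CommutativeMonoid.Sum as MonoidSum
import Algebra.Properties.Semiring.Sum as SemiringSum
open import Data.Bool using (Bool; true; false; T; not; _∧_; _∨_; if_then_else_)
open import Data.Bool.Properties using (T-∧; T-≡; ∨-comm; ∧-zeroʳ; ∧-assoc; ∨-identityʳ; not-involutive)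
open import Data.Empty using (⊥; ⊥-elim)
open import Data.Fin using (Fin; toℕ; punchIn) renaming (zero to fzero; suc to fsuc)
import Data.Fin.Properties as FinP
open import Data.Fin.Permutation using (Permutation′; _⟨$⟩ʳ_; _⟨$⟩ˡ_; inverseˡ)
open import Data.Integer as ℤ using (ℤ; _+_; +_; _-_; 0ℤ; 1ℤ; -1ℤ)
import Data.Integer.Properties as ℤP
import Data.Integer.Tactic.RingSolver as ℤSolver
open import Data.List
  using (List; []; _∷_; _++_; allFin; tabulate; filterᵇ; length; foldr; map; cartesianProduct; take; head; last; null)
open import Data.List.Extrema.Nat using (argmin; argmin-sel; f[argmin]≤f[⊤]; f[argmin]≤f[xs])
open import Data.List.Membership.Propositional using (_∈_)
open import Data.List.Membership.Propositional.Properties using (∈-allFin; ∈-filter⁺; ∈-filter⁻)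
import Data.List.Properties as LP
open import Data.List.Relation.Unary.All as AllL using (All)
import Data.List.Relation.Unary.All.Properties as AllP
open import Data.List.Relation.Unary.AllPairs using (AllPairs; _∷_)
import Data.List.Relation.Unary.AllPairs.Properties as APP
open import Data.List.Relation.Unary.Any using (here; there)
open import Data.List.Relation.Unary.Any.Properties using (¬Any[])
open import Data.Maybe using (just; nothing)
open import Data.Nat as ℕ using (ℕ; zero; suc; _≤_; _<_; _<ᵇ_; z≤n; s≤s)
open import Data.Nat.ListAction using () renaming (sum to listSum)
import Data.Nat.Properties as ℕP
import Data.Nat.Tactic.RingSolver as ℕSolver
open import Data.Product using (Σ; _×_; _,_; proj₁; proj₂)
open import Data.Product.Function.NonDependent.Propositional using (_×-⇔_)
open import Data.Sum using (_⊎_; inj₁; inj₂)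
open import Data.Unit using (tt)
open import Function using (_∘_; id; _⇔_; Equivalence; mk⇔)
open import Function.Properties.Equivalence using () renaming (trans to ⇔-trans)
open import Relation.Binary.Definitions using (tri<; tri≈; tri>)
open import Relation.Binary.PropositionalEquality
open import Relation.Nullary using (¬_; Dec; yes; no)
open import Relation.Nullary.Decidable using (T?)

open MonoidSum ℕP.+-0-commutativeMonoid
  using (sum; sum-syntax; sum-cong-≗; sum-remove; ∑-distrib-+; ∑-comm; sum-permute)
open SemiringSum ℕP.+-*-semiring using (*-distribˡ-sum; *-distribʳ-sum)
module ℤΣ = MonoidSum ℤP.+-0-commutativeMonoid

-- Indicators and finite sums

χ : Bool → ℕ
χ true  = 1
χ false = 0

χ-T : ∀ {b} → T b → χ b ≡ 1
χ-T {true} _ = refl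

χ-F : ∀ {b} → ¬ T b → χ b ≡ 0
χ-F {false} _  = refl
χ-F {true}  ¬t = ⊥-elim (¬t tt)

χ≤1 : ∀ b → χ b ≤ 1
χ≤1 true  = ℕP.≤-refl
χ≤1 false = z≤n

χ-+-≤ : ∀ s {a b} → a ≤ b → (T s → a ≢ b) → χ s ℕ.+ a ≤ b
χ-+-≤ false a≤b _   = a≤b
χ-+-≤ true  a≤b a≢b = ℕP.≤∧≢⇒< a≤b (a≢b tt)

χ-∧ : ∀ x y → χ (x ∧ y) ≡ χ x ℕ.* χ y
χ-∧ false y = refl
χ-∧ true  y = sym (ℕP.*-identityˡ (χ y))

χ-∧-* : ∀ x y z w → χ (x ∧ y ∧ z ∧ w) ≡ χ (x ∧ y) ℕ.* (χ z ℕ.* χ w)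
χ-∧-* x y z w = trans (cong χ (sym (∧-assoc x y (z ∧ w))))
                      (trans (χ-∧ (x ∧ y) (z ∧ w)) (cong (χ (x ∧ y) ℕ.*_) (χ-∧ z w)))

χ-∧-false : ∀ {a c} → c ≡ false → χ (a ∧ c) ≡ 0
χ-∧-false {a} refl = cong χ (∧-zeroʳ a)

χ-∧-mono : ∀ {a b} c → (T a → T b) → χ (a ∧ c) ≤ χ (b ∧ c)
χ-∧-mono {false}        c a⇒b = z≤n
χ-∧-mono {true} {true}  c a⇒b = ℕP.≤-refl
χ-∧-mono {true} {false} c a⇒b = ⊥-elim (a⇒b tt)

χ-straddle : ∀ a b s → (a ≢ b → T s) → χ (a ∧ s) ℕ.+ χ b ≡ χ (b ∧ s) ℕ.+ χ a
χ-straddle false false s _ = refl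
χ-straddle true  true  s _ = refl
χ-straddle false true  s a≢b with s | a≢b (λ ())
... | true | _ = refl
χ-straddle true  false s a≢b with s | a≢b (λ ())
... | true | _ = refl

χ-pair-inclusion-exclusion : ∀ s t g →
  g ℕ.* (χ (not s) ℕ.* χ (not t)) ℕ.+ (χ s ℕ.* g ℕ.+ χ t ℕ.* g) ≡ g ℕ.+ g ℕ.* (χ s ℕ.* χ t)
χ-pair-inclusion-exclusion false false = ℕSolver.solve-∀
χ-pair-inclusion-exclusion false true  = ℕSolver.solve-∀
χ-pair-inclusion-exclusion true  false = ℕSolver.solve-∀
χ-pair-inclusion-exclusion true  true  = ℕSolver.solve-∀

length-filterᵇ-tabulate : ∀ {A : Set} (p : A → Bool) {n} (f : Fin n → A) →
                          length (filterᵇ p (tabulate f)) ≡ sum (χ ∘ p ∘ f)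
length-filterᵇ-tabulate p {zero}  f = refl
length-filterᵇ-tabulate p {suc n} f with p (f fzero)
... | true  = cong suc (length-filterᵇ-tabulate p (f ∘ fsuc))
... | false = length-filterᵇ-tabulate p (f ∘ fsuc)

length-filterᵇ-cartesianProduct : ∀ {A B : Set} (p : A × B → Bool) {m n} (f : Fin m → A) (h : Fin n → B) →
  length (filterᵇ p (cartesianProduct (tabulate f) (tabulate h))) ≡ ∑[ a < m ] ∑[ b < n ] χ (p (f a , h b))
length-filterᵇ-cartesianProduct p {zero}  f h = refl
length-filterᵇ-cartesianProduct {A} {B} p {suc m} f h = begin
  length (filterᵇ p (map (f fzero ,_) (tabulate h) ++ rest))
    ≡⟨ cong length (LP.filter-++ (T? ∘ p) (map (f fzero ,_) (tabulate h)) rest) ⟩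
  length (filterᵇ p (map (f fzero ,_) (tabulate h)) ++ filterᵇ p rest)
    ≡⟨ LP.length-++ (filterᵇ p (map (f fzero ,_) (tabulate h))) ⟩
  length (filterᵇ p (map (f fzero ,_) (tabulate h))) ℕ.+ length (filterᵇ p rest)
    ≡⟨ cong₂ ℕ._+_ (trans (cong (length ∘ filterᵇ p) (LP.map-tabulate h (f fzero ,_)))
                          (length-filterᵇ-tabulate p ((f fzero ,_) ∘ h)))
                   (length-filterᵇ-cartesianProduct p (f ∘ fsuc) h) ⟩
  ∑[ a < suc m ] ∑[ b < _ ] χ (p (f a , h b)) ∎
  where
  open ≡-Reasoning
  rest : List (A × B)
  rest = cartesianProduct (tabulate (f ∘ fsuc)) (tabulate h)

foldr-+-map-allFin : ∀ {n} (h : Fin n → ℤ) → foldr ℤ._+_ 0ℤ (map h (allFin n)) ≡ ℤΣ.sum h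
foldr-+-map-allFin h = go h id
  where
  go : ∀ {A : Set} {n} (h : A → ℤ) (f : Fin n → A) →
       foldr ℤ._+_ 0ℤ (map h (tabulate f)) ≡ ℤΣ.sum (h ∘ f)
  go {n = zero}  h f = refl
  go {n = suc n} h f = cong (ℤ._+_ (h (f fzero))) (go h (f ∘ fsuc))

pos-sum : ∀ {n} (f : Fin n → ℕ) → + sum f ≡ ℤΣ.sum (λ i → + f i)
pos-sum {zero}  f = refl
pos-sum {suc n} f = cong (ℤ._+_ (+ f fzero)) (pos-sum (f ∘ fsuc))

sum-+-pos-sum : ∀ {n} (f : Fin n → ℤ) (g : Fin n → ℕ) →
                ℤΣ.sum f ℤ.+ + sum g ≡ ℤΣ.sum (λ i → f i ℤ.+ + g i)
sum-+-pos-sum f g = trans (cong (ℤ._+_ (ℤΣ.sum f)) (pos-sum g)) (sym (ℤΣ.∑-distrib-+ f (λ i → + g i)))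

sum-mono-≤ : ∀ {n} {f g : Fin n → ℕ} → (∀ i → f i ≤ g i) → sum f ≤ sum g
sum-mono-≤ {zero}  f≤g = z≤n
sum-mono-≤ {suc n} f≤g = ℕP.+-mono-≤ (f≤g fzero) (sum-mono-≤ (f≤g ∘ fsuc))

sum-mono-≤-slack : ∀ {n} {f g : Fin n → ℕ} {m} (k : Fin n) →
                   (∀ i → f i ≤ g i) → m ℕ.+ f k ≤ g k → m ℕ.+ sum f ≤ sum g
sum-mono-≤-slack {suc n} {f} {g} {m} fzero f≤g slack =
  ℕP.≤-trans (ℕP.≤-reflexive (sym (ℕP.+-assoc m (f fzero) (sum (f ∘ fsuc)))))
             (ℕP.+-mono-≤ slack (sum-mono-≤ (f≤g ∘ fsuc)))
sum-mono-≤-slack {suc n} {f} {g} {m} (fsuc k) f≤g slack =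
  ℕP.≤-trans (ℕP.≤-reflexive (swap m (f fzero) (sum (f ∘ fsuc))))
             (ℕP.+-mono-≤ (f≤g fzero) (sum-mono-≤-slack k (f≤g ∘ fsuc) slack))
  where
  swap : ∀ a b c → a ℕ.+ (b ℕ.+ c) ≡ b ℕ.+ (a ℕ.+ c)
  swap = ℕSolver.solve-∀

sum-update : ∀ {n} (f g : Fin n → ℕ) (i : Fin n) → (∀ k → k ≢ i → f k ≡ g k) →
             sum f ℕ.+ g i ≡ sum g ℕ.+ f i
sum-update {suc n} f g i agree = begin
  sum f ℕ.+ g i                        ≡⟨ cong (ℕ._+ g i) (sum-remove f) ⟩
  f i ℕ.+ sum (f ∘ punchIn i) ℕ.+ g i  ≡⟨ cong (λ r → f i ℕ.+ r ℕ.+ g i) (sum-cong-≗ (λ k → agree _ (FinP.punchInᵢ≢i i k)))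
                                         ⟩
  f i ℕ.+ sum (g ∘ punchIn i) ℕ.+ g i  ≡⟨ swap (f i) (sum (g ∘ punchIn i)) (g i) ⟩
  g i ℕ.+ sum (g ∘ punchIn i) ℕ.+ f i  ≡⟨ cong (ℕ._+ f i) (sum-remove g) ⟨
  sum g ℕ.+ f i                        ∎
  where
  open ≡-Reasoning
  swap : ∀ a b c → a ℕ.+ b ℕ.+ c ≡ c ℕ.+ b ℕ.+ a
  swap = ℕSolver.solve-∀

ΣΣ : ∀ {n} → (Fin n → Fin n → ℕ) → ℕ
ΣΣ {n} h = ∑[ a < n ] ∑[ b < n ] h a b

ΣΣ-cong : ∀ {n} {h k : Fin n → Fin n → ℕ} → (∀ a b → h a b ≡ k a b) → ΣΣ h ≡ ΣΣ k
ΣΣ-cong h≡k = sum-cong-≗ (λ a → sum-cong-≗ (h≡k a))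

ΣΣ-+ : ∀ {n} (h k : Fin n → Fin n → ℕ) → ΣΣ (λ a b → h a b ℕ.+ k a b) ≡ ΣΣ h ℕ.+ ΣΣ k
ΣΣ-+ h k = trans (sum-cong-≗ (λ a → ∑-distrib-+ (h a) (k a)))
                 (∑-distrib-+ (λ a → sum (h a)) (λ a → sum (k a)))

module _ {n} (g : Fin n → Fin n → ℕ) where

  degree : Fin n → ℕ
  degree e = sum (g e) ℕ.+ ∑[ a < n ] g a e

  ΣΣ-inclusion-exclusion : (x : Fin n → Bool) →
    ΣΣ (λ a b → g a b ℕ.* (χ (not (x a)) ℕ.* χ (not (x b)))) ℕ.+ sum (λ e → χ (x e) ℕ.* degree e)
    ≡ ΣΣ g ℕ.+ ΣΣ (λ a b → g a b ℕ.* (χ (x a) ℕ.* χ (x b)))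
  ΣΣ-inclusion-exclusion x = begin
    ΣΣ H₀ ℕ.+ sum (λ e → χ (x e) ℕ.* degree e)  ≡⟨ cong (ΣΣ H₀ ℕ.+_) incidences ⟩
    ΣΣ H₀ ℕ.+ (ΣΣ H₁ ℕ.+ ΣΣ H₂)                ≡⟨ cong (ΣΣ H₀ ℕ.+_) (ΣΣ-+ H₁ H₂) ⟨
    ΣΣ H₀ ℕ.+ ΣΣ (λ a b → H₁ a b ℕ.+ H₂ a b)    ≡⟨ ΣΣ-+ H₀ _ ⟨
    ΣΣ (λ a b → H₀ a b ℕ.+ (H₁ a b ℕ.+ H₂ a b))
      ≡⟨ ΣΣ-cong (λ a b → χ-pair-inclusion-exclusion (x a) (x b) (g a b)) ⟩
    ΣΣ (λ a b → g a b ℕ.+ H₃ a b)               ≡⟨ ΣΣ-+ g H₃ ⟩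
    ΣΣ g ℕ.+ ΣΣ H₃                              ∎
    where
    open ≡-Reasoning
    H₀ H₁ H₂ H₃ : Fin n → Fin n → ℕ
    H₀ a b = g a b ℕ.* (χ (not (x a)) ℕ.* χ (not (x b)))
    H₁ a b = χ (x a) ℕ.* g a b
    H₂ a b = χ (x b) ℕ.* g a b
    H₃ a b = g a b ℕ.* (χ (x a) ℕ.* χ (x b))
    incidences : sum (λ e → χ (x e) ℕ.* degree e) ≡ ΣΣ H₁ ℕ.+ ΣΣ H₂
    incidences = begin
      sum (λ e → χ (x e) ℕ.* degree e)
        ≡⟨ sum-cong-≗ (λ e → ℕP.*-distribˡ-+ (χ (x e)) (sum (g e)) _) ⟩
      sum (λ e → χ (x e) ℕ.* sum (g e) ℕ.+ χ (x e) ℕ.* ∑[ a < n ] g a e)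
        ≡⟨ ∑-distrib-+ (λ e → χ (x e) ℕ.* sum (g e)) (λ e → χ (x e) ℕ.* ∑[ a < n ] g a e) ⟩
      sum (λ e → χ (x e) ℕ.* sum (g e)) ℕ.+ sum (λ e → χ (x e) ℕ.* ∑[ a < n ] g a e)
        ≡⟨ cong₂ ℕ._+_ (sum-cong-≗ (λ e → *-distribˡ-sum (χ (x e)) (g e)))
                       (trans (sum-cong-≗ (λ e → *-distribˡ-sum (χ (x e)) (λ a → g a e)))
                              (∑-comm (λ e a → χ (x e) ℕ.* g a e))) ⟩
      ΣΣ H₁ ℕ.+ ΣΣ H₂ ∎

<ᵇ-true : ∀ {m n} → m < n → (m <ᵇ n) ≡ true
<ᵇ-true m<n = Equivalence.to T-≡ (ℕP.<⇒<ᵇ m<n)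

<ᵇ-false : ∀ {m n} → ¬ m < n → (m <ᵇ n) ≡ false
<ᵇ-false {m} {n} m≮n with m <ᵇ n in eq
... | false = refl
... | true  = ⊥-elim (m≮n (ℕP.<ᵇ⇒< m n (subst T (sym eq) tt)))

<ᵇ≡false⇒≥ : ∀ {m n} → (m <ᵇ n) ≡ false → n ≤ m
<ᵇ≡false⇒≥ {m} {n} eq = ℕP.≮⇒≥ (λ m<n → subst T eq (ℕP.<⇒<ᵇ m<n))

T-<ᵇ : ∀ {m n} → T (m <ᵇ n) ⇔ m < n
T-<ᵇ {m} {n} = mk⇔ (ℕP.<ᵇ⇒< m n) ℕP.<⇒<ᵇ

T-not-<ᵇ : ∀ {m n} → T (not (m <ᵇ n)) ⇔ n ≤ m
T-not-<ᵇ {m} {n} = mk⇔ to from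
  where
  to : T (not (m <ᵇ n)) → n ≤ m
  to t = ℕP.≮⇒≥ (λ m<n → subst (T ∘ not) (<ᵇ-true m<n) t)
  from : n ≤ m → T (not (m <ᵇ n))
  from n≤m = subst (T ∘ not) (sym (<ᵇ-false (ℕP.≤⇒≯ n≤m))) tt

implication-⇔ : ∀ {P Q A B C : Set} → P ⇔ (A × B) → Q ⇔ C → (P → Q) ⇔ (A → B → C)
implication-⇔ P⇔ Q⇔ = mk⇔ (λ f a b → Equivalence.to Q⇔ (f (Equivalence.from P⇔ (a , b))))
                          (λ g p → let a , b = Equivalence.to P⇔ p in Equivalence.from Q⇔ (g a b))

T-allᵇ-allFin : ∀ {n} (p : Fin n → Bool) → T (allᵇ p (allFin n)) ⇔ (∀ k → T (p k))
T-allᵇ-allFin {n} p = mk⇔ (AllP.tabulate⁻ ∘ AllP.all⁺ p (allFin n)) (AllP.all⁻ p ∘ AllP.tabulate⁺)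

T-guarded : ∀ c d x y → (T c → T d → ⊥) →
            T (not (c ∨ d) ∨ (c ∧ x) ∨ (d ∧ y)) ⇔ ((T c → T x) × (T d → T y))
T-guarded false false x     y _     = mk⇔ (λ _ → (λ ()) , (λ ())) (λ _ → tt)
T-guarded true  true  x     y c⇒¬d = ⊥-elim (c⇒¬d tt tt)
T-guarded true  false true  y _     = mk⇔ (λ _ → (λ _ → tt) , (λ ())) (λ _ → tt)
T-guarded true  false false y _     = mk⇔ (λ ()) (λ (c⇒x , _) → c⇒x tt)
T-guarded false true  x     y _     = mk⇔ (λ t → (λ ()) , (λ _ → t)) (λ (_ , d⇒y) → d⇒y tt)

diff-suc : ∀ a b → + suc a - + suc b ≡ + a - + b
diff-suc a b = trans ([1+m]⊖[1+n]≡m⊖n a b) (sym (m-n≡m⊖n a b))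
  where open ℤP using ([1+m]⊖[1+n]≡m⊖n; m-n≡m⊖n)

diff-cancelˡ : ∀ k a b → + (k ℕ.+ a) - + (k ℕ.+ b) ≡ + a - + b
diff-cancelˡ zero    a b = refl
diff-cancelˡ (suc k) a b = trans (diff-suc (k ℕ.+ a) (k ℕ.+ b)) (diff-cancelˡ k a b)

diff-shift : ∀ {k m a a′ b b′} → k ℕ.+ a′ ≡ m ℕ.+ a → k ℕ.+ b′ ≡ m ℕ.+ b → + a′ - + b′ ≡ + a - + b
diff-shift {k} {m} {a} {a′} {b} {b′} ea eb = begin
  + a′ - + b′                  ≡⟨ diff-cancelˡ k a′ b′ ⟨
  + (k ℕ.+ a′) - + (k ℕ.+ b′)  ≡⟨ cong₂ (λ x y → + x - + y) ea eb ⟩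
  + (m ℕ.+ a) - + (m ℕ.+ b)    ≡⟨ diff-cancelˡ m a b ⟩
  + a - + b                    ∎
  where open ≡-Reasoning

diff-≡ : ∀ {a b c d} → a ℕ.+ d ≡ c ℕ.+ b → + a - + b ≡ + c - + d
diff-≡ {a} {b} {c} {d} e =
  diff-shift {k = d} {m = b} (trans (ℕP.+-comm d a) (trans e (ℕP.+-comm c b))) (ℕP.+-comm d b)

balance : ∀ {w w′ z z′ p q : ℤ} (P : ℤ) → w′ ℤ.+ p ≡ w ℤ.+ q → z′ ℤ.+ p ≡ z ℤ.+ q →
          w′ ℤ.+ (P - z′) ≡ w ℤ.+ (P - z)
balance {w} {w′} {z} {z′} {p} {q} P ew ez = begin
  w′ ℤ.+ (P - z′)                ≡⟨ regroup w′ z′ p P ⟩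
  (w′ ℤ.+ p) - (z′ ℤ.+ p) ℤ.+ P  ≡⟨ cong₂ (λ x y → x - y ℤ.+ P) ew ez ⟩
  (w ℤ.+ q) - (z ℤ.+ q) ℤ.+ P    ≡⟨ regroup w z q P ⟨
  w ℤ.+ (P - z)                  ∎
  where
  open ≡-Reasoning
  regroup : ∀ w z p P → w ℤ.+ (P - z) ≡ (w ℤ.+ p) - (z ℤ.+ p) ℤ.+ P
  regroup = ℤSolver.solve-∀

0≤ᵇ-diff : ∀ a b → (0ℤ ℤ.≤ᵇ + a - + b) ≡ not (a <ᵇ b)
0≤ᵇ-diff a       zero    = refl
0≤ᵇ-diff zero    (suc b) = refl
0≤ᵇ-diff (suc a) (suc b) = trans (cong (0ℤ ℤ.≤ᵇ_) (diff-suc a b)) (0≤ᵇ-diff a b)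

diff≤ᵇ0 : ∀ a b → (+ a - + b ℤ.≤ᵇ 0ℤ) ≡ not (b <ᵇ a)
diff≤ᵇ0 zero    zero    = refl
diff≤ᵇ0 zero    (suc b) = refl
diff≤ᵇ0 (suc a) zero    = refl
diff≤ᵇ0 (suc a) (suc b) = trans (cong (ℤ._≤ᵇ 0ℤ) (diff-suc a b)) (diff≤ᵇ0 a b)

diff≤ᵇ-1 : ∀ a b → (+ a - + b ℤ.≤ᵇ -1ℤ) ≡ (a <ᵇ b)
diff≤ᵇ-1 a       zero    = refl
diff≤ᵇ-1 zero    (suc b) = refl
diff≤ᵇ-1 (suc a) (suc b) = trans (cong (ℤ._≤ᵇ -1ℤ) (diff-suc a b)) (diff≤ᵇ-1 a b)

-1≤ᵇdiff : ∀ a b → (-1ℤ ℤ.≤ᵇ + a - + b) ≡ not (suc a <ᵇ b)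
-1≤ᵇdiff a       zero          = refl
-1≤ᵇdiff zero    (suc zero)    = refl
-1≤ᵇdiff zero    (suc (suc b)) = refl
-1≤ᵇdiff (suc a) (suc b)       = trans (cong (-1ℤ ℤ.≤ᵇ_) (diff-suc a b)) (-1≤ᵇdiff a b)

T-0≤ᵇ-diff : ∀ a b → T (0ℤ ℤ.≤ᵇ + a - + b) ⇔ b ≤ a
T-0≤ᵇ-diff a b rewrite 0≤ᵇ-diff a b = T-not-<ᵇ

T-diff<ᵇ0 : ∀ a b → T (not (0ℤ ℤ.≤ᵇ + a - + b)) ⇔ a < b
T-diff<ᵇ0 a b rewrite 0≤ᵇ-diff a b | not-involutive (a <ᵇ b) = T-<ᵇ

T-0<ᵇdiff : ∀ a b → T (not (+ a - + b ℤ.≤ᵇ 0ℤ)) ⇔ b < a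
T-0<ᵇdiff a b rewrite diff≤ᵇ0 a b | not-involutive (b <ᵇ a) = T-<ᵇ

T-diff≤ᵇ-1 : ∀ a b → T (+ a - + b ℤ.≤ᵇ -1ℤ) ⇔ a < b
T-diff≤ᵇ-1 a b rewrite diff≤ᵇ-1 a b = T-<ᵇ

T-diff<ᵇ-1 : ∀ a b → T (not (-1ℤ ℤ.≤ᵇ + a - + b)) ⇔ suc a < b
T-diff<ᵇ-1 a b rewrite -1≤ᵇdiff a b | not-involutive (suc a <ᵇ b) = T-<ᵇ

T-diff≡ᵇ0 : ∀ a b → T ((+ a - + b ℤ.≤ᵇ 0ℤ) ∧ (0ℤ ℤ.≤ᵇ + a - + b)) ⇔ a ≡ b
T-diff≡ᵇ0 a b rewrite diff≤ᵇ0 a b | 0≤ᵇ-diff a b = mk⇔ to from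
  where
  to : T (not (b <ᵇ a) ∧ not (a <ᵇ b)) → a ≡ b
  to t = let a≤b , b≤a = Equivalence.to T-∧ t
         in ℕP.≤-antisym (Equivalence.to (T-not-<ᵇ {b}) a≤b) (Equivalence.to (T-not-<ᵇ {a}) b≤a)
  from : a ≡ b → T (not (b <ᵇ a) ∧ not (a <ᵇ b))
  from refl = Equivalence.from (T-∧ {not (a <ᵇ a)}) (a≮a , a≮a)
    where
    a≮a : T (not (a <ᵇ a))
    a≮a = Equivalence.from (T-not-<ᵇ {a} {a}) ℕP.≤-refl

-- the two tests convertible applies to bdiff: d ≥ χ s, and d ≤ −1 − χ s
leftTest rightTest : Bool → ℤ → Bool
leftTest  s d = if s then not (d ℤ.≤ᵇ 0ℤ) else (0ℤ ℤ.≤ᵇ d)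
rightTest s d = if s then not (-1ℤ ℤ.≤ᵇ d) else (d ℤ.≤ᵇ -1ℤ)

T-leftTest : ∀ s a b → T (leftTest s (+ a - + b)) ⇔ χ s ℕ.+ b ≤ a
T-leftTest false = T-0≤ᵇ-diff
T-leftTest true  = T-0<ᵇdiff

T-rightTest : ∀ s a b → T (rightTest s (+ a - + b)) ⇔ χ s ℕ.+ a < b
T-rightTest false = T-diff≤ᵇ-1
T-rightTest true  = T-diff<ᵇ-1

-- wtTerm, which does not depend on the matching
weight : ℤ → ℤ
weight d = if 0ℤ ℤ.≤ᵇ d then d else (ℤ.- d - 1ℤ)

weight-diff-sucˡ : ∀ {a b} → b ≤ a → weight (+ suc a - + b) ≡ weight (+ a - + b) ℤ.+ 1ℤ
weight-diff-sucˡ {a} {zero} z≤n = cong +_ (shift a)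
  where
  shift : ∀ a → suc a ℕ.+ 0 ≡ a ℕ.+ 0 ℕ.+ 1
  shift = ℕSolver.solve-∀
weight-diff-sucˡ {suc a} {suc b} (s≤s b≤a) =
  trans (cong weight (diff-suc (suc a) b))
        (trans (weight-diff-sucˡ b≤a) (cong (λ d → weight d ℤ.+ 1ℤ) (sym (diff-suc a b))))

weight-diff-sucʳ : ∀ {a b} → a < b → weight (+ a - + suc b) ≡ weight (+ a - + b) ℤ.+ 1ℤ
weight-diff-sucʳ {zero}  {suc b} _ = cong +_ (ℕP.+-comm 1 b)
weight-diff-sucʳ {suc a} {suc b} (s≤s a<b) =
  trans (cong weight (diff-suc a (suc b)))
        (trans (weight-diff-sucʳ a<b) (cong (λ d → weight d ℤ.+ 1ℤ) (sym (diff-suc a b))))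

weight-shiftˡ : ∀ s {a a′ b} → χ s ℕ.+ a′ ≡ χ (not s) ℕ.+ a → χ s ℕ.+ b ≤ a →
                weight (+ a′ - + b) ℤ.+ + χ s ≡ weight (+ a - + b) ℤ.+ + χ (not s)
weight-shiftˡ false refl b≤a = trans (ℤP.+-identityʳ _) (weight-diff-sucˡ b≤a)
weight-shiftˡ true  refl b<a = sym (trans (ℤP.+-identityʳ _) (weight-diff-sucˡ (ℕP.≤-pred b<a)))

weight-shiftʳ : ∀ s {a b b′} → χ s ℕ.+ b′ ≡ χ (not s) ℕ.+ b → χ s ℕ.+ a < b →
                weight (+ a - + b′) ℤ.+ + χ s ≡ weight (+ a - + b) ℤ.+ + χ (not s)
weight-shiftʳ false refl a<b   = trans (ℤP.+-identityʳ _) (weight-diff-sucʳ a<b)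
weight-shiftʳ true  refl a+1<b = sym (trans (ℤP.+-identityʳ _) (weight-diff-sucʳ (ℕP.≤-pred a+1<b)))

module _ {A : Set} where

  head≡just⇒∈ : ∀ {xs : List A} {z} → head xs ≡ just z → z ∈ xs
  head≡just⇒∈ {_ ∷ _} refl = here refl

  head≡nothing⇒[] : ∀ {xs : List A} → head xs ≡ nothing → xs ≡ []
  head≡nothing⇒[] {[]} _ = refl

  last≡just⇒∈ : ∀ {xs : List A} {z} → last xs ≡ just z → z ∈ xs
  last≡just⇒∈ {x ∷ []}     refl = here refl
  last≡just⇒∈ {x ∷ y ∷ xs} eq   = there (last≡just⇒∈ {y ∷ xs} eq)

  last≡nothing⇒[] : ∀ {xs : List A} → last xs ≡ nothing → xs ≡ []
  last≡nothing⇒[] {[]}         _  = refl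
  last≡nothing⇒[] {x ∷ y ∷ xs} eq with last≡nothing⇒[] {y ∷ xs} eq
  ... | ()

  last-maximal : ∀ {R : A → A → Set} {xs z y} → AllPairs R xs → last xs ≡ just z → y ∈ xs →
                 y ≡ z ⊎ R y z
  last-maximal {xs = x ∷ []}     _            refl (here refl) = inj₁ refl
  last-maximal {xs = x ∷ y ∷ xs} (x< ∷ _)     eq   (here refl) = inj₂ (AllL.lookup x< (last≡just⇒∈ {y ∷ xs} eq))
  last-maximal {xs = x ∷ y ∷ xs} (_ ∷ sorted) eq   (there y∈)  = last-maximal sorted eq y∈

  null≡false⇒∷ : ∀ {xs : List A} → null xs ≡ false → Σ A λ x → Σ (List A) λ ys → xs ≡ x ∷ ys
  null≡false⇒∷ {x ∷ ys} _ = x , ys , refl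

  ∈-argmin : ∀ (f : A → ℕ) x xs → argmin f x xs ∈ x ∷ xs
  ∈-argmin f x xs with argmin-sel f x xs
  ... | inj₁ ≡x  = here ≡x
  ... | inj₂ ∈xs = there ∈xs

  argmin-minimal : ∀ (f : A → ℕ) x xs {y} → y ∈ x ∷ xs → f (argmin f x xs) ≤ f y
  argmin-minimal f x xs (here refl) = f[argmin]≤f[⊤] {f = f} x xs
  argmin-minimal f x xs (there y∈)  = AllL.lookup (f[argmin]≤f[xs] {f = f} x xs) y∈

module _ {n} (p : Fin n → Bool) where

  private
    filtered : List (Fin n)
    filtered = filterᵇ p (allFin n)

  filterᵇ-allFin-sorted : AllPairs (λ a b → toℕ a < toℕ b) filtered
  filterᵇ-allFin-sorted = APP.filter⁺ (T? ∘ p) (APP.tabulate⁺-< id)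

  ∈-filterᵇ-allFin : ∀ k → T (p k) → k ∈ filtered
  ∈-filterᵇ-allFin k = ∈-filter⁺ (T? ∘ p) (∈-allFin k)

  filterᵇ-allFin-[] : filtered ≡ [] → ∀ k → ¬ T (p k)
  filterᵇ-allFin-[] eq k pk = ¬Any[] (subst (k ∈_) eq (∈-filterᵇ-allFin k pk))

  filterᵇ-allFin-head : ∀ {i rest} → filtered ≡ i ∷ rest → T (p i) × (∀ k → toℕ k < toℕ i → ¬ T (p k))
  filterᵇ-allFin-head {i} eq =
    proj₂ (∈-filter⁻ (T? ∘ p) {xs = allFin n} (subst (i ∈_) (sym eq) (here refl))) , earlier
    where
    earlier : ∀ k → toℕ k < toℕ i → ¬ T (p k)
    earlier k k<i pk with subst (k ∈_) eq (∈-filterᵇ-allFin k pk) | subst (AllPairs _) eq filterᵇ-allFin-sorted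
    ... | here refl | _      = ℕP.<-irrefl refl k<i
    ... | there k∈  | i< ∷ _ = ℕP.<-asym k<i (AllL.lookup i< k∈)

  filterᵇ-allFin-last : ∀ {i} → last filtered ≡ just i → T (p i) × (∀ k → T (p k) → toℕ k ≤ toℕ i)
  filterᵇ-allFin-last {i} eq =
    proj₂ (∈-filter⁻ (T? ∘ p) {xs = allFin n} (last≡just⇒∈ {xs = filtered} eq)) , later
    where
    later : ∀ k → T (p k) → toℕ k ≤ toℕ i
    later k pk with last-maximal filterᵇ-allFin-sorted eq (∈-filterᵇ-allFin k pk)
    ... | inj₁ refl = ℕP.≤-refl
    ... | inj₂ k<i  = ℕP.<⇒≤ k<i

module _ {n} (pos : Fin n → ℕ) where

  below : (Fin n → Bool) → ℕ → ℕ
  below S x = sum (λ u → χ ((pos u <ᵇ x) ∧ S u))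

  below-mono : ∀ S {x y} → x ≤ y → below S x ≤ below S y
  below-mono S {x} {y} x≤y = sum-mono-≤ (λ u → χ-∧-mono (S u) (raise u))
    where
    raise : ∀ u → T (pos u <ᵇ x) → T (pos u <ᵇ y)
    raise u = ℕP.<⇒<ᵇ ∘ (λ p<x → ℕP.<-≤-trans p<x x≤y) ∘ ℕP.<ᵇ⇒< (pos u) x

  below-gap : ∀ S z {x y} → x ≤ pos z → pos z < y → χ (S z) ℕ.+ below S x ≤ below S y
  below-gap S z {x} {y} x≤z z<y = sum-mono-≤-slack z (λ u → χ-∧-mono (S u) (raise u)) at-z
    where
    raise : ∀ u → T (pos u <ᵇ x) → T (pos u <ᵇ y)
    raise u = ℕP.<⇒<ᵇ ∘ (λ p<x → ℕP.<-trans p<x (ℕP.≤-<-trans x≤z z<y)) ∘ ℕP.<ᵇ⇒< (pos u) x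
    at-z : χ (S z) ℕ.+ χ ((pos z <ᵇ x) ∧ S z) ≤ χ ((pos z <ᵇ y) ∧ S z)
    at-z rewrite <ᵇ-false (ℕP.≤⇒≯ x≤z) | <ᵇ-true z<y = ℕP.≤-reflexive (ℕP.+-identityʳ (χ (S z)))

  below-gap₂ : ∀ S z₁ z₂ {x y} → x ≤ pos z₁ → pos z₁ < pos z₂ → pos z₂ < y →
               χ (S z₂) ℕ.+ (χ (S z₁) ℕ.+ below S x) ≤ below S y
  below-gap₂ S z₁ z₂ x≤z₁ z₁<z₂ z₂<y =
    ℕP.≤-trans (ℕP.+-monoʳ-≤ (χ (S z₂)) (below-gap S z₁ x≤z₁ z₁<z₂)) (below-gap S z₂ ℕP.≤-refl z₂<y)

  below-update : ∀ S S′ i x → (∀ k → k ≢ i → S′ k ≡ S k) →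
                 χ ((pos i <ᵇ x) ∧ S i) ℕ.+ below S′ x ≡ χ ((pos i <ᵇ x) ∧ S′ i) ℕ.+ below S x
  below-update S S′ i x agree =
    trans (ℕP.+-comm _ (below S′ x))
          (trans (sum-update _ _ i (λ k k≢i → cong (λ s → χ ((pos k <ᵇ x) ∧ s)) (agree k k≢i)))
                 (ℕP.+-comm (below S x) _))

-- Blocks

blockStart : List ℕ → ℕ → ℕ
blockStart ns k = listSum (take k ns)

block-mono : ∀ ns {x y} → x ≤ y → block ns x ≤ block ns y
block-mono []       x≤y = z≤n
block-mono (n ∷ ns) {x} {y} x≤y with x <ᵇ n in x<n | y <ᵇ n in y<n
... | true  | _     = z≤n
... | false | false = s≤s (block-mono ns (ℕP.∸-monoˡ-≤ n x≤y))
... | false | true  =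
  ⊥-elim (ℕP.<-irrefl refl (ℕP.<-≤-trans (ℕP.≤-<-trans x≤y y<n′) (<ᵇ≡false⇒≥ {x} {n} x<n)))
  where y<n′ = ℕP.<ᵇ⇒< y n (subst T (sym y<n) tt)

<blockStart⇒block< : ∀ ns k {x} → x < blockStart ns k → block ns x < k
<blockStart⇒block< (n ∷ ns) (suc k) {x} x<start with x <ᵇ n in x<n
... | true  = s≤s z≤n
... | false = s≤s (<blockStart⇒block< ns k (ℕP.+-cancelˡ-< n _ _
                    (subst (ℕ._< n ℕ.+ blockStart ns k) (sym (ℕP.m+[n∸m]≡n (<ᵇ≡false⇒≥ {x} {n} x<n)))
                           x<start)))

block<⇒<blockStart : ∀ ns k {x} → x < Tot ns → block ns x < k → x < blockStart ns k
block<⇒<blockStart (n ∷ ns) (suc k) {x} x<tot block<k with x <ᵇ n in x<n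
... | true  = ℕP.<-≤-trans (ℕP.<ᵇ⇒< x n (subst T (sym x<n) tt)) (ℕP.m≤m+n n _)
... | false = subst (ℕ._< n ℕ.+ blockStart ns k) (ℕP.m+[n∸m]≡n n≤x)
                    (ℕP.+-monoʳ-< n (block<⇒<blockStart ns k x∸n<tot (ℕP.≤-pred block<k)))
  where
  n≤x : n ≤ x
  n≤x = <ᵇ≡false⇒≥ x<n
  x∸n<tot : x ℕ.∸ n < Tot ns
  x∸n<tot = ℕP.+-cancelˡ-< n _ _ (subst (ℕ._< n ℕ.+ Tot ns) (sym (ℕP.m+[n∸m]≡n n≤x)) x<tot)

blockStart≤ : ∀ ns {k x} → k ≤ block ns x → blockStart ns k ≤ x
blockStart≤ ns k≤block = ℕP.≮⇒≥ (λ x<start → ℕP.<⇒≱ (<blockStart⇒block< ns _ x<start) k≤block)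

<ᵇblockStart≡ : ∀ ns k {x} → x < Tot ns → (x <ᵇ blockStart ns k) ≡ (block ns x <ᵇ k)
<ᵇblockStart≡ ns k {x} x<tot with block ns x ℕ.<? k
... | yes b<k = trans (<ᵇ-true (block<⇒<blockStart ns k x<tot b<k)) (sym (<ᵇ-true b<k))
... | no  b≮k = trans (<ᵇ-false (b≮k ∘ <blockStart⇒block< ns k)) (sym (<ᵇ-false b≮k))

module Matching {N} (ns : List ℕ) (π : Permutation′ N) where

  upper lower : Fin N → ℕ
  upper = toℕ
  lower i = toℕ (π ⟨$⟩ʳ i)

  lower-injective : ∀ {i j} → lower i ≡ lower j → i ≡ j
  lower-injective {i} {j} eq = begin
    i                  ≡⟨ inverseˡ π ⟨
    π ⟨$⟩ˡ (π ⟨$⟩ʳ i)  ≡⟨ cong (π ⟨$⟩ˡ_) (FinP.toℕ-injective eq) ⟩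
    π ⟨$⟩ˡ (π ⟨$⟩ʳ j)  ≡⟨ inverseˡ π ⟩
    j                  ∎
    where open ≡-Reasoning

  -- U S j = bind^U(j) − 1 and L S j = bind^L(π j) − 1
  U L : (Fin N → Bool) → Fin N → ℕ
  U S j = below upper S (upper j)
  L S j = below lower S (lower j)

  bdiff≡ : ∀ S j → bdiff ns π S j ≡ + L S j - + U S j
  bdiff≡ S j = trans
    (cong₂ (λ a b → + suc a - + suc b)
           (trans (length-filterᵇ-tabulate (λ v → (toℕ v <ᵇ lower j) ∧ S (π ⟨$⟩ˡ v)) id)
                  (trans (sum-permute _ π)
                         (sum-cong-≗ (λ u → cong (λ w → χ ((lower u <ᵇ lower j) ∧ S w)) (inverseˡ π)))))
           (length-filterᵇ-tabulate (λ u → (toℕ u <ᵇ toℕ j) ∧ S u) id))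
    (diff-suc (L S j) (U S j))

  T-bdiff : ∀ S j (test : ℤ → Bool) {P : ℕ → ℕ → Set} →
            (∀ a b → T (test (+ a - + b)) ⇔ P a b) → T (test (bdiff ns π S j)) ⇔ P (L S j) (U S j)
  T-bdiff S j test T-test rewrite bdiff≡ S j = T-test (L S j) (U S j)

  wt≡ : ∀ S → wt ns π S ≡ ℤΣ.sum (λ j → weight (+ L S j - + U S j))
  wt≡ S = trans (foldr-+-map-allFin (λ j → weight (bdiff ns π S j)))
                (ℤΣ.sum-cong-≗ (λ j → cong weight (bdiff≡ S j)))

  below-cut : ∀ S t → (∀ u → (upper u <ᵇ t) ≢ (lower u <ᵇ t) → T (S u)) →
              below upper S t ≡ below lower S t
  below-cut S t straddling⇒marked = ℕP.+-cancelʳ-≡ _ _ _ (begin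
    below upper S t ℕ.+ sum (λ u → χ (upper u <ᵇ t))
      ≡⟨ cong (below upper S t ℕ.+_) (sum-permute _ π) ⟩
    below upper S t ℕ.+ sum (λ u → χ (lower u <ᵇ t))
      ≡⟨ ∑-distrib-+ (λ u → χ ((upper u <ᵇ t) ∧ S u)) _ ⟨
    sum (λ u → χ ((upper u <ᵇ t) ∧ S u) ℕ.+ χ (lower u <ᵇ t))
      ≡⟨ sum-cong-≗ (λ u → χ-straddle (upper u <ᵇ t) (lower u <ᵇ t) (S u) (straddling⇒marked u)) ⟩
    sum (λ u → χ ((lower u <ᵇ t) ∧ S u) ℕ.+ χ (upper u <ᵇ t))
      ≡⟨ ∑-distrib-+ (λ u → χ ((lower u <ᵇ t) ∧ S u)) _ ⟩
    below lower S t ℕ.+ sum (λ u → χ (upper u <ᵇ t)) ∎)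
    where open ≡-Reasoning

  toggle-self : ∀ S i → toggle ns π S i i ≡ not (S i)
  toggle-self S i with toℕ i ℕ.≡ᵇ toℕ i in eq
  ... | true  = refl
  ... | false = ⊥-elim (subst T eq (ℕP.≡⇒≡ᵇ (toℕ i) (toℕ i) refl))

  toggle-other : ∀ S i k → k ≢ i → toggle ns π S i k ≡ S k
  toggle-other S i k k≢i with toℕ k ℕ.≡ᵇ toℕ i in eq
  ... | false = refl
  ... | true  = ⊥-elim (k≢i (FinP.toℕ-injective (ℕP.≡ᵇ⇒≡ (toℕ k) (toℕ i) (subst T (sym eq) tt))))

  U-toggle : ∀ S i j {b} → (upper i <ᵇ upper j) ≡ b →
             χ (b ∧ S i) ℕ.+ U (toggle ns π S i) j ≡ χ (b ∧ not (S i)) ℕ.+ U S j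
  U-toggle S i j refl = subst (λ s → χ ((upper i <ᵇ upper j) ∧ S i) ℕ.+ U (toggle ns π S i) j
                                   ≡ χ ((upper i <ᵇ upper j) ∧ s) ℕ.+ U S j)
    (toggle-self S i) (below-update upper S (toggle ns π S i) i (upper j) (toggle-other S i))

  L-toggle : ∀ S i j {b} → (lower i <ᵇ lower j) ≡ b →
             χ (b ∧ S i) ℕ.+ L (toggle ns π S i) j ≡ χ (b ∧ not (S i)) ℕ.+ L S j
  L-toggle S i j refl = subst (λ s → χ ((lower i <ᵇ lower j) ∧ S i) ℕ.+ L (toggle ns π S i) j
                                   ≡ χ ((lower i <ᵇ lower j) ∧ s) ℕ.+ L S j)
    (toggle-self S i) (below-update lower S (toggle ns π S i) i (lower j) (toggle-other S i))

  -- crossesLeft ns π S and crosses ns π S, which do not depend on S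
  crossesLeftᵇ crossesᵇ : Fin N → Fin N → Bool
  crossesLeftᵇ j i = (upper j <ᵇ upper i) ∧ (lower i <ᵇ lower j)
  crossesᵇ a b = crossesLeftᵇ a b ∨ crossesLeftᵇ b a

  T-crossesLeftᵇ : ∀ j i → T (crossesLeftᵇ j i) ⇔ (upper j < upper i × lower i < lower j)
  T-crossesLeftᵇ j i = mk⇔ (λ t → let a , b = Equivalence.to T-∧ t in ℕP.<ᵇ⇒< _ _ a , ℕP.<ᵇ⇒< _ _ b)
                           (λ (a , b) → Equivalence.from T-∧ (ℕP.<⇒<ᵇ a , ℕP.<⇒<ᵇ b))

  crossesᵇ-≡ : ∀ {i j a b c d} → (upper j <ᵇ upper i) ≡ a → (lower i <ᵇ lower j) ≡ b →
               (upper i <ᵇ upper j) ≡ c → (lower j <ᵇ lower i) ≡ d → crossesᵇ j i ≡ (a ∧ b) ∨ (c ∧ d)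
  crossesᵇ-≡ e₁ e₂ e₃ e₄ = cong₂ _∨_ (cong₂ _∧_ e₁ e₂) (cong₂ _∧_ e₃ e₄)

  crossesᵇ-sym : ∀ a b → crossesᵇ a b ≡ crossesᵇ b a
  crossesᵇ-sym a b = ∨-comm (crossesLeftᵇ a b) (crossesLeftᵇ b a)

  data Crossing (i j : Fin N) : Set where
    fromLeft  : upper j < upper i → lower i < lower j → Crossing i j
    fromRight : upper i < upper j → lower j < lower i → Crossing i j
    apart     : (upper i <ᵇ upper j) ≡ (lower i <ᵇ lower j) → crossesᵇ j i ≡ false → Crossing i j

  crossing : ∀ i j → Crossing i j
  crossing i j with ℕ.<-cmp (upper j) (upper i) | ℕ.<-cmp (lower j) (lower i)
  ... | tri< j<i _ _ | tri> _ _ i<j′ = fromLeft j<i i<j′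
  ... | tri> _ _ i<j | tri< j<i′ _ _ = fromRight i<j j<i′
  ... | tri< j<i _ _ | tri< j<i′ _ _ =
    apart (trans i≮j (sym i≮j′)) (crossesᵇ-≡ (<ᵇ-true j<i) i≮j′ i≮j (<ᵇ-true j<i′))
    where
    i≮j = <ᵇ-false (ℕP.<⇒≯ j<i)
    i≮j′ = <ᵇ-false (ℕP.<⇒≯ j<i′)
  ... | tri> _ _ i<j | tri> _ _ i<j′ =
    apart (trans (<ᵇ-true i<j) (sym (<ᵇ-true i<j′))) (crossesᵇ-≡ j≮i (<ᵇ-true i<j′) (<ᵇ-true i<j) j≮i′)
    where
    j≮i = <ᵇ-false (ℕP.<⇒≯ i<j)
    j≮i′ = <ᵇ-false (ℕP.<⇒≯ i<j′)
  ... | tri< j<i _ _ | tri≈ _ j≡i′ _ = ⊥-elim (ℕP.<-irrefl (cong upper (lower-injective j≡i′)) j<i)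
  ... | tri> _ _ i<j | tri≈ _ j≡i′ _ = ⊥-elim (ℕP.<-irrefl (cong upper (lower-injective (sym j≡i′))) i<j)
  ... | tri≈ _ j≡i _ | _ with FinP.toℕ-injective j≡i
  ...   | refl = apart (trans i≮i (sym i≮i′)) (crossesᵇ-≡ i≮i i≮i′ i≮i i≮i′)
    where
    i≮i = <ᵇ-false (ℕP.<-irrefl {upper i} refl)
    i≮i′ = <ᵇ-false (ℕP.<-irrefl {lower i} refl)

  orderedCrossing : Fin N → Fin N → ℕ
  orderedCrossing a b = χ ((upper a <ᵇ upper b) ∧ crossesᵇ a b)

  degree-orderedCrossing : ∀ e → degree orderedCrossing e ≡ sum (λ j → χ (crossesᵇ j e))
  degree-orderedCrossing e = trans (sym (∑-distrib-+ (orderedCrossing e) (λ a → orderedCrossing a e)))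
                                   (sum-cong-≗ both-orders)
    where
    both-orders : ∀ j → orderedCrossing e j ℕ.+ orderedCrossing j e ≡ χ (crossesᵇ j e)
    both-orders j with crossing e j
    ... | fromLeft j<e _ = cong₂ ℕ._+_ (cong (λ b → χ (b ∧ crossesᵇ e j)) (<ᵇ-false (ℕP.<⇒≯ j<e)))
                                        (cong (λ b → χ (b ∧ crossesᵇ j e)) (<ᵇ-true j<e))
    ... | fromRight e<j _ = trans (cong₂ ℕ._+_ (cong (λ b → χ (b ∧ crossesᵇ e j)) (<ᵇ-true e<j))
                                               (cong (λ b → χ (b ∧ crossesᵇ j e)) (<ᵇ-false (ℕP.<⇒≯ e<j))))
                                  (trans (ℕP.+-identityʳ _) (cong χ (crossesᵇ-sym e j)))
    ... | apart _ j∤e = trans (cong₂ ℕ._+_ (χ-∧-false {upper e <ᵇ upper j} (trans (crossesᵇ-sym e j) j∤e))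
                                           (χ-∧-false {upper j <ᵇ upper e} j∤e))
                              (cong χ (sym j∤e))

  crossPairs≡ : ∀ S p → crossPairs ns π S p ≡ ΣΣ (λ a b → orderedCrossing a b ℕ.* (χ (p a) ℕ.* χ (p b)))
  crossPairs≡ S p = trans (length-filterᵇ-cartesianProduct crossingPair id id)
                          (ΣΣ-cong (λ a b → χ-∧-* (upper a <ᵇ upper b) (crossesᵇ a b) (p a) (p b)))
    where
    crossingPair : Fin N × Fin N → Bool
    crossingPair (a , b) = (upper a <ᵇ upper b) ∧ crossesᵇ a b ∧ p a ∧ p b

  markedDegree : (Fin N → Bool) → ℕ
  markedDegree S = sum (λ e → χ (S e) ℕ.* degree orderedCrossing e)

  cross≡ : ∀ S → cross ns π S ≡ + ΣΣ orderedCrossing - + markedDegree S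
  cross≡ S = diff-≡ {b = crossPairs ns π S S} {d = markedDegree S} (begin
    crossPairs ns π S (not ∘ S) ℕ.+ markedDegree S
      ≡⟨ cong (ℕ._+ markedDegree S) (crossPairs≡ S (not ∘ S)) ⟩
    ΣΣ (λ a b → orderedCrossing a b ℕ.* (χ (not (S a)) ℕ.* χ (not (S b)))) ℕ.+ markedDegree S
      ≡⟨ ΣΣ-inclusion-exclusion orderedCrossing S ⟩
    ΣΣ orderedCrossing ℕ.+ ΣΣ (λ a b → orderedCrossing a b ℕ.* (χ (S a) ℕ.* χ (S b)))
      ≡⟨ cong (ΣΣ orderedCrossing ℕ.+_) (crossPairs≡ S S) ⟨
    ΣΣ orderedCrossing ℕ.+ crossPairs ns π S S ∎)
    where open ≡-Reasoning

  markedDegree-toggle : ∀ S i → + markedDegree (toggle ns π S i) ℤ.+ + (χ (S i) ℕ.* degree orderedCrossing i)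
                              ≡ + markedDegree S ℤ.+ + (χ (not (S i)) ℕ.* degree orderedCrossing i)
  markedDegree-toggle S i = begin
    + markedDegree (toggle ns π S i) ℤ.+ + (χ (S i) ℕ.* degree orderedCrossing i)
      ≡⟨ ℤP.pos-+ (markedDegree (toggle ns π S i)) _ ⟨
    + (markedDegree (toggle ns π S i) ℕ.+ χ (S i) ℕ.* degree orderedCrossing i)
      ≡⟨ cong +_ (sum-update _ (λ e → χ (S e) ℕ.* degree orderedCrossing e) i
                   (λ k k≢i → cong (λ s → χ s ℕ.* degree orderedCrossing k) (toggle-other S i k k≢i))) ⟩
    + (markedDegree S ℕ.+ χ (toggle ns π S i i) ℕ.* degree orderedCrossing i)
      ≡⟨ cong (λ s → + (markedDegree S ℕ.+ χ s ℕ.* degree orderedCrossing i)) (toggle-self S i) ⟩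
    + (markedDegree S ℕ.+ χ (not (S i)) ℕ.* degree orderedCrossing i)
      ≡⟨ ℤP.pos-+ (markedDegree S) _ ⟩
    + markedDegree S ℤ.+ + (χ (not (S i)) ℕ.* degree orderedCrossing i) ∎
    where open ≡-Reasoning

  -- χ (S i) + U S j ≤ L S j says bdiff(e_j) ≥ χ (S i): nonstrict for unmarked e_i, strict for marked
  LeftBound RightBound : (Fin N → Bool) → Fin N → Fin N → Set
  LeftBound  S i j = upper j < upper i → lower i < lower j → χ (S i) ℕ.+ U S j ≤ L S j
  RightBound S i j = upper i < upper j → lower j < lower i → χ (S i) ℕ.+ L S j < U S j

  record Convertible (S : Fin N → Bool) (i : Fin N) : Set where
    field
      leftBound  : ∀ j → LeftBound S i j
      rightBound : ∀ j → RightBound S i j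

  convertibleAt : (Fin N → Bool) → Fin N → Fin N → Bool
  convertibleAt S i j = not (crossesᵇ j i) ∨ (crossesLeftᵇ j i ∧ leftTest (S i) (bdiff ns π S j))
                                           ∨ (crossesLeftᵇ i j ∧ rightTest (S i) (bdiff ns π S j))

  convertible≡ : ∀ S i → convertible ns π S i ≡ allᵇ (convertibleAt S i) (allFin N)
  convertible≡ S i with S i
  ... | true  = refl
  ... | false = refl

  convertibleAt⇔ : ∀ S i j → T (convertibleAt S i j) ⇔ (LeftBound S i j × RightBound S i j)
  convertibleAt⇔ S i j = ⇔-trans (T-guarded (crossesLeftᵇ j i) (crossesLeftᵇ i j) _ _ one-sided)
    (implication-⇔ (T-crossesLeftᵇ j i) (T-bdiff S j (leftTest (S i)) (T-leftTest (S i))) ×-⇔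
     implication-⇔ (T-crossesLeftᵇ i j) (T-bdiff S j (rightTest (S i)) (T-rightTest (S i))))
    where
    one-sided : T (crossesLeftᵇ j i) → T (crossesLeftᵇ i j) → ⊥
    one-sided l r = ℕP.<-asym (proj₁ (Equivalence.to (T-crossesLeftᵇ j i) l))
                              (proj₁ (Equivalence.to (T-crossesLeftᵇ i j) r))

  convertible⇔ : ∀ S i → T (convertible ns π S i) ⇔ Convertible S i
  convertible⇔ S i rewrite convertible≡ S i = ⇔-trans (T-allᵇ-allFin (convertibleAt S i)) (mk⇔ to from)
    where
    to : (∀ j → T (convertibleAt S i j)) → Convertible S i
    to t = record { leftBound  = λ j → proj₁ (Equivalence.to (convertibleAt⇔ S i j) (t j))
                  ; rightBound = λ j → proj₂ (Equivalence.to (convertibleAt⇔ S i j) (t j)) }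
    from : Convertible S i → ∀ j → T (convertibleAt S i j)
    from c j = Equivalence.from (convertibleAt⇔ S i j) (Convertible.leftBound c j , Convertible.rightBound c j)

  -- Toggling a convertible edge

  module _ (S : Fin N → Bool) (i : Fin N) (convertible-i : Convertible S i) where
    open Convertible convertible-i

    private
      S′ : Fin N → Bool
      S′ = toggle ns π S i

    weight-toggle : ∀ j → weight (+ L S′ j - + U S′ j) ℤ.+ + χ (crossesᵇ j i ∧ S i)
                        ≡ weight (+ L S j - + U S j) ℤ.+ + χ (crossesᵇ j i ∧ not (S i))
    weight-toggle j with crossing i j
    ... | fromLeft j<i i<j′
      rewrite crossesᵇ-≡ (<ᵇ-true j<i) (<ᵇ-true i<j′) (<ᵇ-false (ℕP.<⇒≯ j<i)) (<ᵇ-false (ℕP.<⇒≯ i<j′))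
            | U-toggle S i j (<ᵇ-false (ℕP.<⇒≯ j<i))
      = weight-shiftˡ (S i) (L-toggle S i j (<ᵇ-true i<j′)) (leftBound j j<i i<j′)
    ... | fromRight i<j j<i′
      rewrite crossesᵇ-≡ (<ᵇ-false (ℕP.<⇒≯ i<j)) (<ᵇ-false (ℕP.<⇒≯ j<i′)) (<ᵇ-true i<j) (<ᵇ-true j<i′)
            | L-toggle S i j (<ᵇ-false (ℕP.<⇒≯ j<i′))
      = weight-shiftʳ (S i) (U-toggle S i j (<ᵇ-true i<j)) (rightBound j i<j j<i′)
    ... | apart same j∤i rewrite j∤i =
      cong (λ d → weight d ℤ.+ 0ℤ)
           (diff-shift {a = L S j} {L S′ j} {U S j} {U S′ j} (L-toggle S i j (sym same)) (U-toggle S i j refl))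

    crossings-∧ : ∀ s → sum (λ j → χ (crossesᵇ j i ∧ s)) ≡ χ s ℕ.* degree orderedCrossing i
    crossings-∧ s = begin
      sum (λ j → χ (crossesᵇ j i ∧ s))      ≡⟨ sum-cong-≗ (λ j → χ-∧ (crossesᵇ j i) s) ⟩
      sum (λ j → χ (crossesᵇ j i) ℕ.* χ s)  ≡⟨ *-distribʳ-sum (χ s) (λ j → χ (crossesᵇ j i)) ⟨
      sum (λ j → χ (crossesᵇ j i)) ℕ.* χ s  ≡⟨ ℕP.*-comm _ (χ s) ⟩
      χ s ℕ.* sum (λ j → χ (crossesᵇ j i))  ≡⟨ cong (χ s ℕ.*_) (degree-orderedCrossing i) ⟨
      χ s ℕ.* degree orderedCrossing i      ∎
      where open ≡-Reasoning

    wt-toggle : wt ns π S′ ℤ.+ + (χ (S i) ℕ.* degree orderedCrossing i)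
              ≡ wt ns π S ℤ.+ + (χ (not (S i)) ℕ.* degree orderedCrossing i)
    wt-toggle = begin
      wt ns π S′ ℤ.+ + (χ (S i) ℕ.* degree orderedCrossing i)
        ≡⟨ cong₂ ℤ._+_ (wt≡ S′) (cong +_ (sym (crossings-∧ (S i)))) ⟩
      ℤΣ.sum (λ j → weight (+ L S′ j - + U S′ j)) ℤ.+ + sum (λ j → χ (crossesᵇ j i ∧ S i))
        ≡⟨ sum-+-pos-sum _ (λ j → χ (crossesᵇ j i ∧ S i)) ⟩
      ℤΣ.sum (λ j → weight (+ L S′ j - + U S′ j) ℤ.+ + χ (crossesᵇ j i ∧ S i))
        ≡⟨ ℤΣ.sum-cong-≗ weight-toggle ⟩
      ℤΣ.sum (λ j → weight (+ L S j - + U S j) ℤ.+ + χ (crossesᵇ j i ∧ not (S i)))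
        ≡⟨ sum-+-pos-sum _ (λ j → χ (crossesᵇ j i ∧ not (S i))) ⟨
      ℤΣ.sum (λ j → weight (+ L S j - + U S j)) ℤ.+ + sum (λ j → χ (crossesᵇ j i ∧ not (S i)))
        ≡⟨ cong₂ ℤ._+_ (sym (wt≡ S)) (cong +_ (crossings-∧ (not (S i)))) ⟩
      wt ns π S ℤ.+ + (χ (not (S i)) ℕ.* degree orderedCrossing i) ∎
      where open ≡-Reasoning

    toggle-preserves : wt ns π S′ ℤ.+ cross ns π S′ ≡ wt ns π S ℤ.+ cross ns π S
    toggle-preserves = begin
      wt ns π S′ ℤ.+ cross ns π S′
        ≡⟨ cong (ℤ._+_ (wt ns π S′)) (cross≡ S′) ⟩
      wt ns π S′ ℤ.+ (+ ΣΣ orderedCrossing - + markedDegree S′)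
        ≡⟨ balance {wt ns π S} {wt ns π S′} {+ markedDegree S} {+ markedDegree S′}
                   (+ ΣΣ orderedCrossing) wt-toggle (markedDegree-toggle S i) ⟩
      wt ns π S ℤ.+ (+ ΣΣ orderedCrossing - + markedDegree S)
        ≡⟨ cong (ℤ._+_ (wt ns π S)) (cross≡ S) ⟨
      wt ns π S ℤ.+ cross ns π S ∎
      where open ≡-Reasoning

-- The case analysis of Φ

module MarkedMatching (ns : List ℕ) (π : Permutation′ (Tot ns)) (S : Fin (Tot ns) → Bool)
                      (marked : Marked ns π S) where
  open Matching ns π

  Homogeneous : Fin (Tot ns) → Set
  Homogeneous j = T (hom ns π S j)

  homogeneous⇔ : ∀ j → Homogeneous j ⇔ block ns (upper j) ≡ block ns (lower j)
  homogeneous⇔ j = mk⇔ (ℕP.≡ᵇ⇒≡ _ _) (ℕP.≡⇒≡ᵇ _ _)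

  inhomogeneous⇒marked : ∀ j → ¬ Homogeneous j → T (S j)
  inhomogeneous⇒marked j ¬hom with hom ns π S j in eq
  ... | true  = ⊥-elim (¬hom tt)
  ... | false = Equivalence.from T-≡ (marked j eq)

  unmarked⇒homogeneous : ∀ j → ¬ T (S j) → Homogeneous j
  unmarked⇒homogeneous j unmarked with T? (hom ns π S j)
  ... | yes h = h
  ... | no ¬h = ⊥-elim (unmarked (inhomogeneous⇒marked j ¬h))

  blockStart-cut : ∀ k → below upper S (blockStart ns k) ≡ below lower S (blockStart ns k)
  blockStart-cut k = below-cut S (blockStart ns k) straddling⇒marked
    where
    straddling⇒marked : ∀ u → (upper u <ᵇ blockStart ns k) ≢ (lower u <ᵇ blockStart ns k) → T (S u)
    straddling⇒marked u differ = inhomogeneous⇒marked u λ h → differ (begin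
      upper u <ᵇ blockStart ns k            ≡⟨ <ᵇblockStart≡ ns k (FinP.toℕ<n u) ⟩
      block ns (upper u) <ᵇ k          ≡⟨ cong (_<ᵇ k) (Equivalence.to (homogeneous⇔ u) h) ⟩
      block ns (lower u) <ᵇ k          ≡⟨ <ᵇblockStart≡ ns k (FinP.toℕ<n (π ⟨$⟩ʳ u)) ⟨
      lower u <ᵇ blockStart ns k            ∎)
      where open ≡-Reasoning

  BalancedLeftCrosser : Fin (Tot ns) → Fin (Tot ns) → Set
  BalancedLeftCrosser i j = upper j < upper i × Homogeneous j × U S j ≡ L S j × lower i < lower j

  balancedLeftCrosserᵇ : Fin (Tot ns) → Fin (Tot ns) → Bool
  balancedLeftCrosserᵇ i j =
    (upper j <ᵇ upper i) ∧ hom ns π S j ∧ ((bdiff ns π S j ℤ.≤ᵇ 0ℤ) ∧ (0ℤ ℤ.≤ᵇ bdiff ns π S j))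
                         ∧ crossesᵇ j i

  minLower-convertible : ∀ i → Homogeneous i → (∀ k → Homogeneous k → U S k ≤ L S k) →
                         (∀ k → Homogeneous k → lower i ≤ lower k) → Convertible S i
  minLower-convertible i hom-i nonneg minimal = record { leftBound = left ; rightBound = right }
    where
    open ℕP.≤-Reasoning
    r : ℕ
    r = block ns (upper i)

    left : ∀ j → LeftBound S i j
    left j j<i i<j′ = begin
      χ (S i) ℕ.+ U S j  ≤⟨ ℕP.+-monoʳ-≤ (χ (S i)) (below-mono upper S (ℕP.<⇒≤ j<i)) ⟩
      χ (S i) ℕ.+ U S i  ≤⟨ ℕP.+-monoʳ-≤ (χ (S i)) (nonneg i hom-i) ⟩
      χ (S i) ℕ.+ L S i  ≤⟨ below-gap lower S i ℕP.≤-refl i<j′ ⟩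
      L S j              ∎

    right : ∀ j → RightBound S i j
    right j i<j j<i′ = via-block (block ns (lower j) ℕ.<? r)
      where
      ¬hom-j : ¬ Homogeneous j
      ¬hom-j h = ℕP.<⇒≱ j<i′ (minimal j h)
      marked-j : χ (S i) ℕ.+ L S j < χ (S i) ℕ.+ (χ (S j) ℕ.+ L S j)
      marked-j = ℕP.+-monoʳ-< (χ (S i))
        (ℕP.≤-reflexive (cong (ℕ._+ L S j) (sym (χ-T (inhomogeneous⇒marked j ¬hom-j)))))
      block-i : block ns (lower i) ≡ r
      block-i = sym (Equivalence.to (homogeneous⇔ i) hom-i)
      via-block : Dec (block ns (lower j) < r) → χ (S i) ℕ.+ L S j < U S j
      -- e_j's lower endpoint lies in an earlier block than e_i: cut at the start of block r
      via-block (yes before) = begin-strict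
        χ (S i) ℕ.+ L S j                      <⟨ marked-j ⟩
        χ (S i) ℕ.+ (χ (S j) ℕ.+ L S j)
          ≤⟨ ℕP.+-monoʳ-≤ (χ (S i)) (below-gap lower S j ℕP.≤-refl j<start) ⟩
        χ (S i) ℕ.+ below lower S (blockStart ns r) ≡⟨ cong (χ (S i) ℕ.+_) (blockStart-cut r) ⟨
        χ (S i) ℕ.+ below upper S (blockStart ns r) ≤⟨ below-gap upper S i (blockStart≤ ns ℕP.≤-refl) i<j ⟩
        U S j                                  ∎
        where
        j<start : lower j < blockStart ns r
        j<start = block<⇒<blockStart ns r (FinP.toℕ<n (π ⟨$⟩ʳ j)) before
      -- e_j's upper endpoint lies in a later block than its lower one, which is e_i's: cut at block r + 1
      via-block (no ¬before) = begin-strict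
        χ (S i) ℕ.+ L S j                      <⟨ marked-j ⟩
        χ (S i) ℕ.+ (χ (S j) ℕ.+ L S j)        ≤⟨ below-gap₂ lower S j i ℕP.≤-refl j<i′ i<start ⟩
        below lower S (blockStart ns (suc r))       ≡⟨ blockStart-cut (suc r) ⟨
        below upper S (blockStart ns (suc r))       ≤⟨ below-mono upper S (blockStart≤ ns r<block-j) ⟩
        U S j                                  ∎
        where
        i<start : lower i < blockStart ns (suc r)
        i<start = block<⇒<blockStart ns (suc r) (FinP.toℕ<n (π ⟨$⟩ʳ i)) (s≤s (ℕP.≤-reflexive block-i))
        block-j : block ns (lower j) ≡ r
        block-j = ℕP.≤-antisym (subst (block ns (lower j) ≤_) block-i (block-mono ns (ℕP.<⇒≤ j<i′)))
                               (ℕP.≮⇒≥ ¬before)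
        r<block-j : r < block ns (upper j)
        r<block-j = ℕP.≤∧≢⇒< (block-mono ns (ℕP.<⇒≤ i<j))
                              (λ r≡ → ¬hom-j (Equivalence.from (homogeneous⇔ j) (trans (sym r≡) (sym block-j))))

  firstNegative-convertible : ∀ i → Homogeneous i → L S i < U S i →
    (∀ k → Homogeneous k → upper k < upper i → U S k ≤ L S k) →
    (T (S i) → ∀ j → ¬ BalancedLeftCrosser i j) →
    Convertible S i
  firstNegative-convertible i hom-i negative earlier-nonneg no-balanced =
    record { leftBound = left ; rightBound = right }
    where
    open ℕP.≤-Reasoning

    left : ∀ j → LeftBound S i j
    left j j<i i<j′ with T? (hom ns π S j)
    ... | yes hom-j = χ-+-≤ (S i) (earlier-nonneg j hom-j j<i) (λ s bal → no-balanced s j (j<i , hom-j , bal , i<j′))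
    -- an inhomogeneous left crosser leaves its block before e_i's block starts
    ... | no ¬hom-j = begin
      χ (S i) ℕ.+ U S j                ≤⟨ ℕP.+-monoˡ-≤ (U S j) χ-i≤χ-j ⟩
      χ (S j) ℕ.+ U S j                ≤⟨ below-gap upper S j ℕP.≤-refl j<start ⟩
      below upper S (blockStart ns (suc b)) ≡⟨ blockStart-cut (suc b) ⟩
      below lower S (blockStart ns (suc b)) ≤⟨ below-mono lower S (blockStart≤ ns b<block-j′) ⟩
      L S j                            ∎
      where
      b : ℕ
      b = block ns (upper j)
      χ-i≤χ-j : χ (S i) ≤ χ (S j)
      χ-i≤χ-j = subst (χ (S i) ≤_) (sym (χ-T (inhomogeneous⇒marked j ¬hom-j))) (χ≤1 (S i))
      j<start : upper j < blockStart ns (suc b)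
      j<start = block<⇒<blockStart ns (suc b) (FinP.toℕ<n j) (ℕP.n<1+n b)
      b<block-j′ : b < block ns (lower j)
      b<block-j′ = ℕP.≤∧≢⇒< (ℕP.≤-trans (block-mono ns (ℕP.<⇒≤ j<i))
                               (ℕP.≤-trans (ℕP.≤-reflexive (Equivalence.to (homogeneous⇔ i) hom-i))
                                           (block-mono ns (ℕP.<⇒≤ i<j′))))
                             (¬hom-j ∘ Equivalence.from (homogeneous⇔ j))

    right : ∀ j → RightBound S i j
    right j i<j j<i′ = begin-strict
      χ (S i) ℕ.+ L S j                ≤⟨ ℕP.+-monoʳ-≤ (χ (S i)) (ℕP.m≤n+m (L S j) (χ (S j))) ⟩
      χ (S i) ℕ.+ (χ (S j) ℕ.+ L S j)  ≤⟨ ℕP.+-monoʳ-≤ (χ (S i)) (below-gap lower S j ℕP.≤-refl j<i′) ⟩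
      χ (S i) ℕ.+ L S i                <⟨ ℕP.+-monoʳ-< (χ (S i)) negative ⟩
      χ (S i) ℕ.+ U S i                ≤⟨ below-gap upper S i ℕP.≤-refl i<j ⟩
      U S j                            ∎

  module _ (i i′ : Fin (Tot ns)) (marked-i : T (S i))
           (earlier-nonneg : ∀ k → Homogeneous k → upper k < upper i → U S k ≤ L S k)
           (crosser-i′ : BalancedLeftCrosser i i′)
           (last : ∀ k → BalancedLeftCrosser i k → upper k ≤ upper i′) where

    private
      open ℕP.≤-Reasoning

      i′<i : upper i′ < upper i
      i′<i = proj₁ crosser-i′

      balanced : U S i′ ≡ L S i′
      balanced = proj₁ (proj₂ (proj₂ crosser-i′))

      i<i′′ : lower i < lower i′
      i<i′′ = proj₂ (proj₂ (proj₂ crosser-i′))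

      below-i′ : ∀ k → lower k < lower i′ → χ (S k) ℕ.+ L S k ≤ U S i′
      below-i′ k k<i′′ = ℕP.≤-trans (below-gap lower S k ℕP.≤-refl k<i′′) (ℕP.≤-reflexive (sym balanced))

      through-i′ : ∀ k → upper i′ < upper k → L S k < L S i′ → χ (S i′) ℕ.+ L S k < U S k
      through-i′ k i′<k key = begin-strict
        χ (S i′) ℕ.+ L S k   <⟨ ℕP.+-monoʳ-< (χ (S i′)) key ⟩
        χ (S i′) ℕ.+ L S i′  ≡⟨ cong (χ (S i′) ℕ.+_) balanced ⟨
        χ (S i′) ℕ.+ U S i′  ≤⟨ below-gap upper S i′ ℕP.≤-refl i′<k ⟩
        U S k                ∎

      unmarked-rightBound : ∀ k → upper i′ < upper k → lower k < lower i′ → ¬ T (S k) →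
                            χ (S i′) ℕ.+ L S k < U S k
      unmarked-rightBound k i′<k k<i′′ unmarked-k with ℕ.<-cmp (upper k) (upper i)
      ... | tri> _ _ i<k = begin-strict
        χ (S i′) ℕ.+ L S k
          ≤⟨ ℕP.+-monoʳ-≤ (χ (S i′)) (ℕP.≤-trans (ℕP.m≤n+m (L S k) (χ (S k))) (below-i′ k k<i′′)) ⟩
        χ (S i′) ℕ.+ U S i′                    <⟨ ℕP.n<1+n _ ⟩
        suc (χ (S i′) ℕ.+ U S i′)              ≡⟨ cong (ℕ._+ (χ (S i′) ℕ.+ U S i′)) (χ-T marked-i) ⟨
        χ (S i) ℕ.+ (χ (S i′) ℕ.+ U S i′)      ≤⟨ below-gap₂ upper S i′ i ℕP.≤-refl i′<i i<k ⟩
        U S k                                  ∎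
      ... | tri≈ _ k≡i _ = ⊥-elim (unmarked-k (subst (T ∘ S) (sym (FinP.toℕ-injective k≡i)) marked-i))
      ... | tri< k<i _ _ with ℕ.<-cmp (lower k) (lower i)
      ...   | tri< k<i′ _ _ = through-i′ k i′<k (begin-strict
        L S k                            ≡⟨ cong (ℕ._+ L S k) (χ-F unmarked-k) ⟨
        χ (S k) ℕ.+ L S k                <⟨ ℕP.n<1+n _ ⟩
        suc (χ (S k) ℕ.+ L S k)          ≡⟨ cong (ℕ._+ (χ (S k) ℕ.+ L S k)) (χ-T marked-i) ⟨
        χ (S i) ℕ.+ (χ (S k) ℕ.+ L S k)  ≤⟨ below-gap₂ lower S k i ℕP.≤-refl k<i′ i<i′′ ⟩
        L S i′                           ∎)
      ...   | tri≈ _ k≡i′ _ = ⊥-elim (ℕP.<-irrefl (cong upper (lower-injective k≡i′)) k<i)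
      -- e_k would be a later balanced homogeneous left crosser of e_i than e_i′, or one with bdiff < 0
      ...   | tri> _ _ i<k′ with U S k ℕ.≟ L S k
      ...     | yes balanced-k = ⊥-elim (ℕP.<⇒≱ i′<k (last k (k<i , hom-k , balanced-k , i<k′)))
        where
        hom-k : Homogeneous k
        hom-k = unmarked⇒homogeneous k unmarked-k
      ...     | no unbalanced-k = ⊥-elim (ℕP.<-irrefl refl (begin-strict
        U S k              <⟨ ℕP.≤∧≢⇒< (earlier-nonneg k (unmarked⇒homogeneous k unmarked-k) k<i) unbalanced-k ⟩
        L S k              ≤⟨ ℕP.m≤n+m (L S k) (χ (S k)) ⟩
        χ (S k) ℕ.+ L S k  ≤⟨ below-i′ k k<i′′ ⟩
        U S i′             ≤⟨ below-mono upper S (ℕP.<⇒≤ i′<k) ⟩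
        U S k              ∎))

      left : ∀ k → LeftBound S i′ k
      left k k<i′ i′<k′ = begin
        χ (S i′) ℕ.+ U S k   ≤⟨ ℕP.+-monoʳ-≤ (χ (S i′)) (below-mono upper S (ℕP.<⇒≤ k<i′)) ⟩
        χ (S i′) ℕ.+ U S i′  ≡⟨ cong (χ (S i′) ℕ.+_) balanced ⟩
        χ (S i′) ℕ.+ L S i′  ≤⟨ below-gap lower S i′ ℕP.≤-refl i′<k′ ⟩
        L S k                ∎

      right : ∀ k → RightBound S i′ k
      right k i′<k k<i′′ with T? (S k)
      ... | yes marked-k = through-i′ k i′<k
        (subst (_≤ L S i′) (cong (ℕ._+ L S k) (χ-T marked-k)) (below-gap lower S k ℕP.≤-refl k<i′′))
      ... | no unmarked-k = unmarked-rightBound k i′<k k<i′′ unmarked-k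

    lastBalanced-convertible : Convertible S i′
    lastBalanced-convertible = record { leftBound = left ; rightBound = right }

  T-balancedLeftCrosser : ∀ i j → T (balancedLeftCrosserᵇ i j) ⇔ BalancedLeftCrosser i j
  T-balancedLeftCrosser i j = mk⇔ to from
    where
    balanced⇔ : T ((bdiff ns π S j ℤ.≤ᵇ 0ℤ) ∧ (0ℤ ℤ.≤ᵇ bdiff ns π S j)) ⇔ L S j ≡ U S j
    balanced⇔ = T-bdiff S j (λ d → (d ℤ.≤ᵇ 0ℤ) ∧ (0ℤ ℤ.≤ᵇ d)) T-diff≡ᵇ0
    crosses⇔ : upper j < upper i → T (crossesᵇ j i) ⇔ lower i < lower j
    crosses⇔ j<i rewrite crossesᵇ-≡ {i} {j} (<ᵇ-true j<i) refl (<ᵇ-false (ℕP.<⇒≯ j<i)) refl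
                       | ∨-identityʳ (lower i <ᵇ lower j) = T-<ᵇ
    to : T (balancedLeftCrosserᵇ i j) → BalancedLeftCrosser i j
    to t with Equivalence.to T-∧ t
    ... | j<i , t′ with Equivalence.to T-∧ t′
    ...   | hom-j , t″ with Equivalence.to T-∧ t″
    ...     | balanced , crosses = let j<i′ = Equivalence.to T-<ᵇ j<i in
      j<i′ , hom-j , sym (Equivalence.to balanced⇔ balanced) , Equivalence.to (crosses⇔ j<i′) crosses
    from : BalancedLeftCrosser i j → T (balancedLeftCrosserᵇ i j)
    from (j<i , hom-j , balanced , i<j′) = Equivalence.from T-∧ (ℕP.<⇒<ᵇ j<i ,
      Equivalence.from T-∧ (hom-j , Equivalence.from T-∧ (Equivalence.from balanced⇔ (sym balanced) ,
        Equivalence.from (crosses⇔ j<i) i<j′)))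

  T-negative : ∀ j → T (not (0ℤ ℤ.≤ᵇ bdiff ns π S j)) ⇔ L S j < U S j
  T-negative j = T-bdiff S j (λ d → not (0ℤ ℤ.≤ᵇ d)) T-diff<ᵇ0

  no-negative : negHoms ns π S ≡ [] → ∀ k → Homogeneous k → U S k ≤ L S k
  no-negative none k hom-k = ℕP.≮⇒≥ λ negative →
    filterᵇ-allFin-[] _ none k (Equivalence.from T-∧ (hom-k , Equivalence.from (T-negative k) negative))

  first-negative : ∀ {i rest} → negHoms ns π S ≡ i ∷ rest →
    Homogeneous i × L S i < U S i × (∀ k → Homogeneous k → upper k < upper i → U S k ≤ L S k)
  first-negative {i} first with filterᵇ-allFin-head _ first
  ... | negative-i , earlier = hom-i , Equivalence.to (T-negative i) negative , earlier-nonneg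
    where
    hom-i : Homogeneous i
    hom-i = proj₁ (Equivalence.to T-∧ negative-i)
    negative : T (not (0ℤ ℤ.≤ᵇ bdiff ns π S i))
    negative = proj₂ (Equivalence.to (T-∧ {hom ns π S i}) negative-i)
    earlier-nonneg : ∀ k → Homogeneous k → upper k < upper i → U S k ≤ L S k
    earlier-nonneg k hom-k k<i = ℕP.≮⇒≥ λ negative-k →
      earlier k k<i (Equivalence.from T-∧ (hom-k , Equivalence.from (T-negative k) negative-k))

  lowestᵇ : Fin (Tot ns) → Bool
  lowestᵇ i = allᵇ (λ j → lower i ℕ.≤ᵇ lower j) (homs ns π S)

  lowest-homogeneous : ∀ {i} → argminLower ns π S ≡ just i →
    Homogeneous i × (∀ k → Homogeneous k → lower i ≤ lower k)
  lowest-homogeneous eq with ∈-filter⁻ (T? ∘ lowestᵇ) {xs = homs ns π S} (head≡just⇒∈ eq)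
  ... | i∈homs , lowest-i =
    proj₂ (∈-filter⁻ (T? ∘ hom ns π S) {xs = allFin (Tot ns)} i∈homs) ,
    λ k hom-k → ℕP.≤ᵇ⇒≤ _ _ (AllL.lookup (AllP.all⁺ _ (homs ns π S) lowest-i)
                                          (∈-filterᵇ-allFin (hom ns π S) k hom-k))

  lowest-homogeneous-exists : null (homs ns π S) ≡ false → argminLower ns π S ≢ nothing
  lowest-homogeneous-exists nonempty none with null≡false⇒∷ nonempty
  ... | x , xs , homs≡ =
    ¬Any[] (subst (m ∈_) (head≡nothing⇒[] none) (∈-filter⁺ (T? ∘ lowestᵇ) m∈homs lowest-m))
    where
    m : Fin (Tot ns)
    m = argmin lower x xs
    m∈homs : m ∈ homs ns π S
    m∈homs = subst (m ∈_) (sym homs≡) (∈-argmin lower x xs)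
    lowest-m : T (lowestᵇ m)
    lowest-m = AllP.all⁻ _ (AllL.tabulate λ y∈ →
      ℕP.≤⇒≤ᵇ (argmin-minimal lower x xs (subst (_ ∈_) homs≡ y∈)))

  module _ {i rest} (negatives : negHoms ns π S ≡ i ∷ rest) (not-convertible : convertible ns π S i ≡ false) where

    private
      unconvertible : ¬ Convertible S i
      unconvertible = subst T not-convertible ∘ Equivalence.from (convertible⇔ S i)

      firstNegative-convertible′ : (T (S i) → ∀ j → ¬ BalancedLeftCrosser i j) → Convertible S i
      firstNegative-convertible′ =
        let hom-i , negative-i , earlier-nonneg = first-negative negatives
        in firstNegative-convertible i hom-i negative-i earlier-nonneg

    -- an unmarked first negative edge is convertible
    marked-first-negative : T (S i)
    marked-first-negative with T? (S i)
    ... | yes marked-i  = marked-i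
    ... | no unmarked-i = ⊥-elim (unconvertible (firstNegative-convertible′ (⊥-elim ∘ unmarked-i)))

    balanced-crosser-exists : case2b ns π S i ≢ nothing
    balanced-crosser-exists none = unconvertible (firstNegative-convertible′ (λ _ → no-candidate))
      where
      no-candidate : ∀ j → ¬ BalancedLeftCrosser i j
      no-candidate j = filterᵇ-allFin-[] _ (last≡nothing⇒[] none) j ∘ Equivalence.from (T-balancedLeftCrosser i j)

    last-balanced-convertible : ∀ {i′} → case2b ns π S i ≡ just i′ → Convertible S i′
    last-balanced-convertible {i′} last-eq with filterᵇ-allFin-last _ last-eq
    ... | candidate-i′ , later = lastBalanced-convertible i i′ marked-first-negative
            (proj₂ (proj₂ (first-negative negatives)))
            (Equivalence.to (T-balancedLeftCrosser i i′) candidate-i′)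
            (λ k → later k ∘ Equivalence.from (T-balancedLeftCrosser i k))

  Φ-toggles-convertible : Φ ns π S ≡ just (π , S) ⊎
                          Σ (Fin (Tot ns)) λ i → Φ ns π S ≡ just (π , toggle ns π S i) × Convertible S i
  Φ-toggles-convertible with null (homs ns π S) in nonempty
  ... | true = inj₁ refl
  ... | false with negHoms ns π S in negatives
  ...   | [] with argminLower ns π S in lowest
  ...     | nothing = ⊥-elim (lowest-homogeneous-exists nonempty lowest)
  ...     | just i  = let hom-i , lowest-i = lowest-homogeneous lowest in
    inj₂ (i , refl , minLower-convertible i hom-i (no-negative negatives) lowest-i)
  Φ-toggles-convertible | false | i ∷ rest with convertible ns π S i in convertible-i
  ... | true  = inj₂ (i , refl , Equivalence.to (convertible⇔ S i) (Equivalence.from T-≡ convertible-i))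
  ... | false with case2b ns π S i in last-eq
  ...   | nothing = ⊥-elim (balanced-crosser-exists negatives convertible-i last-eq)
  ...   | just i′ = inj₂ (i′ , refl , last-balanced-convertible negatives convertible-i last-eq)

lemma4p7 : (ns : List ℕ) → All (λ n → 0 < n) ns →
    (π : Permutation′ (Tot ns)) (S : Fin (Tot ns) → Bool) → Marked ns π S →
    Σ (Raw (Tot ns)) λ m′ → (Φ ns π S ≡ just m′) ×
      (wtR ns m′ + crossR ns m′ ≡ wt ns π S + cross ns π S)
lemma4p7 ns _ π S marked with MarkedMatching.Φ-toggles-convertible ns π S marked
... | inj₁ unchanged = (π , S) , unchanged , refl
... | inj₂ (i , toggled , convertible-i) =
  (π , toggle ns π S i) , toggled , Matching.toggle-preserves ns π S i convertible-i
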